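{- Let $G$ be a connected AT-free graph, let $s\geq 2$ be an integer, and suppose ${\rm diam}(G)>s$. If $k$ is the minimum number of edges that need to be contracted in $G$ in order to obtain a graph of diameter at most $s$, then ${\rm diam}(G)-s\leq k\leq {\rm diam}(G)-s+2$.
   Context: All graphs are finite, simple and undirected. ${\rm diam}(G)$ is the maximum distance between two vertices of $G$. Contracting an edge $uv$ replaces $u,v$ by a new vertex adjacent to exactly the vertices that were adjacent to $u$ or $v$. An asteroidal triple is a set of three pairwise non-adjacent vertices such that between each pair of them there is a path containing no neighbor of the third; a graph is AT-free if it has no asteroidal triple. -}

module Defs where

open import Data.Nat using (ℕ; zero; suc; _≤_)
open import Data.Fin using (Fin)
open import Data.Product using (Σ; _×_; ∃; ∃-syntax)
open import Data.Sum using (_⊎_)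
open import Relation.Nullary using (¬_)
open import Relation.Binary.PropositionalEquality using (_≡_; _≢_)

record Graph (n : ℕ) : Set₁ where
  field
    Adj    : Fin n → Fin n → Set
    sym    : ∀ {x y} → Adj x y → Adj y x
    irrefl : ∀ {x} → ¬ Adj x x
open Graph public

data Walk {n : ℕ} (G : Graph n) : Fin n → Fin n → ℕ → Set where
  nil  : ∀ x → Walk G x x 0
  cons : ∀ {x y z l} → Adj G x y → Walk G y z l → Walk G x z (suc l)

Dist≤ : ∀ {n} → Graph n → Fin n → Fin n → ℕ → Set
Dist≤ G x y d = ∃[ l ] (l ≤ d × Walk G x y l)

Connected : ∀ {n} → Graph n → Set
Connected G = ∀ x y → ∃[ l ] Walk G x y l

DiamAtMost : ∀ {n} → Graph n → ℕ → Set
DiamAtMost G d = ∀ x y → Dist≤ G x y d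

Diam : ∀ {n} → Graph n → ℕ → Set
Diam G d = DiamAtMost G d × (∀ e → DiamAtMost G e → d ≤ e)

data AvoidReach {n : ℕ} (G : Graph n) (z : Fin n) : Fin n → Fin n → Set where
  here : ∀ {x} → ¬ Adj G x z → AvoidReach G z x x
  step : ∀ {x y w} → ¬ Adj G x z → Adj G x y → AvoidReach G z y w → AvoidReach G z x w

AsteroidalTriple : ∀ {n} → Graph n → Fin n → Fin n → Fin n → Set
AsteroidalTriple G x y z =
  (x ≢ y) × (y ≢ z) × (x ≢ z) ×
  (¬ Adj G x y) × (¬ Adj G y z) × (¬ Adj G x z) ×
  AvoidReach G z x y × AvoidReach G x y z × AvoidReach G y x z

ATFree : ∀ {n} → Graph n → Set
ATFree G = ∀ x y z → ¬ AsteroidalTriple G x y z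

-- H is (isomorphic to) the graph obtained from G by contracting the edge uv:
-- f identifies exactly u and v, and H's adjacency is the induced one.
record ContractEdge {n : ℕ} (G : Graph (suc n)) (H : Graph n) : Set where
  field
    u v   : Fin (suc n)
    edge  : Adj G u v
    f     : Fin (suc n) → Fin n
    fuv   : f u ≡ f v
    onto  : ∀ a → ∃[ x ] (f x ≡ a)
    inj   : ∀ x y → f x ≡ f y → x ≡ y ⊎ ((x ≡ u × y ≡ v) ⊎ (x ≡ v × y ≡ u))
    adj→  : ∀ a b → Adj H a b →
              (a ≢ b) × ∃[ x ] ∃[ y ] (f x ≡ a × f y ≡ b × Adj G x y)
    adj←  : ∀ a b → a ≢ b → ∀ x y → f x ≡ a → f y ≡ b → Adj G x y → Adj H a b

data Contracts : ∀ {n m} → Graph n → Graph m → ℕ → Set₁ where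
  done : ∀ {n} (G : Graph n) → Contracts G G 0
  step : ∀ {n m k} {G : Graph (suc n)} {H : Graph n} {K : Graph m} →
         ContractEdge G H → Contracts H K k → Contracts G K (suc k)

Achieves : ∀ {n} → Graph n → ℕ → ℕ → Set₁
Achieves G s k = Σ ℕ λ m → Σ (Graph m) λ H → Contracts G H k × DiamAtMost H s

MinContractions : ∀ {n} → Graph n → ℕ → ℕ → Set₁
MinContractions G s k = Achieves G s k × (∀ j → Achieves G s j → k ≤ j)

-- Lower bound: contracting one edge lowers every distance by at most one, so k contractions
-- leave diameter at least diam(G) − k.
-- Upper bound: an AT-free graph has a dominating pair (a , b), i.e. every a–b walk is
-- dominating (Corneil, Olariu and Stewart). Take an a–b walk of length at most diam(G)
-- and contract all but s − 2 of its edges: what is left is a dominating walk of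
-- length at most s − 2, and any two vertices, each on or next to it, are at distance at most s.
-- The dominating pair is found by two maximality arguments: choose x, w with the component
-- C of G − N[x] containing w as large as possible, then y ∈ C with the component of G − N[y]
-- containing x as large as possible. A vertex z ≠ x missed by some x–y walk would either
-- enlarge one of these components or form an asteroidal triple with x and y.
module Submission where

open import Defs
open import Data.Empty using (⊥-elim)
open import Data.Fin using (Fin; zero; suc; _≟_; punchIn; punchOut)
open import Data.Fin.Properties
  using (punchOut-cong; punchOut-injective; punchOut-punchIn; punchInᵢ≢i)
open import Data.Fin.Subset using (Subset; ∣_∣; Nonempty; _⊂_) renaming (_∈_ to _∈ₛ_)
open import Data.Fin.Subset.Properties
  using (p⊂q⇒∣p∣<∣q∣; ⊥⊆; ∉⊥; ∣⊥∣≡0; nonempty?; Empty-unique)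
open import Data.List using (List; []; _∷_; length; map; allFin; cartesianProduct)
open import Data.List.Extrema.Nat using (argmax; f[xs]≤f[argmax])
open import Data.List.Membership.Propositional using (_∈_; find)
open import Data.List.Membership.Propositional.Properties
  using (∈-allFin; ∈-cartesianProduct⁺)
open import Data.List.Properties using (length-map)
import Data.List.Relation.Unary.All as All
open import Data.List.Relation.Unary.Any as Any using (Any; here; there)
import Data.List.Relation.Unary.Any.Properties as Anyₚ
open import Data.List.Relation.Unary.Linked as Linked using (Linked; [-]; _∷_)
import Data.List.Relation.Unary.Linked.Properties as Linkedₚ
open import Data.Nat using (ℕ; zero; suc; _≤_; _<_; _∸_; _+_; z≤n; s≤s; _≤?_)
open import Data.Nat.Properties
  using ( ≤-refl; ≤-reflexive; ≤-trans; <-irrefl; <⇒≱; n≤1+n; m≤n⇒m≤1+n; m≤n+m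
        ; +-comm; +-assoc; +-suc; +-mono-≤; m≤n+m∸n; m≤n+o⇒m∸n≤o)
open import Data.Product using (Σ; ∃; ∃-syntax; ∃₂; _×_; _,_; proj₁; proj₂; uncurry)
open import Data.Sum using (_⊎_; inj₁; inj₂; [_,_]′)
import Data.Sum as Sum
open import Data.Vec using (tabulate)
open import Data.Vec.Properties using (lookup∘tabulate; []=⇒lookup; lookup⇒[]=)
open import Function using (_∘_; id)
open import Relation.Binary.Construct.Closure.Reflexive using (ReflClosure; refl; [_])
open import Relation.Binary.PropositionalEquality
  using (_≡_; _≢_; refl; trans; cong; subst; ≢-sym) renaming (sym to ≡-sym)
open import Relation.Nullary using (¬_; Dec; yes; no; does)
open import Relation.Nullary.Decidable
  using (¬?; _×-dec_; dec-true; decidable-stable; ¬¬-excluded-middle)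

module _ {n : ℕ} {G : Graph n} where

  _++ʷ_ : ∀ {x y z l m} → Walk G x y l → Walk G y z m → Walk G x z (l + m)
  nil _    ++ʷ q = q
  cons a p ++ʷ q = cons a (p ++ʷ q)

  dist-refl : ∀ {x} → Dist≤ G x x 0
  dist-refl = 0 , z≤n , nil _

  dist-adj : ∀ {x y} → Adj G x y → Dist≤ G x y 1
  dist-adj x∼y = 1 , ≤-refl , cons x∼y (nil _)

  dist-mono : ∀ {x y d e} → d ≤ e → Dist≤ G x y d → Dist≤ G x y e
  dist-mono d≤e (l , l≤d , w) = l , ≤-trans l≤d d≤e , w

  dist-trans : ∀ {x y z d e} → Dist≤ G x y d → Dist≤ G y z e → Dist≤ G x z (d + e)
  dist-trans (l , l≤d , p) (m , m≤e , q) = l + m , +-mono-≤ l≤d m≤e , p ++ʷ q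

  walk-reverse : ∀ {x y l} → Walk G x y l → Dist≤ G y x l
  walk-reverse (nil _)      = dist-refl
  walk-reverse (cons x∼y w) =
    dist-mono (≤-reflexive (+-comm _ 1)) (dist-trans (walk-reverse w) (dist-adj (sym G x∼y)))

  dist-sym : ∀ {x y d} → Dist≤ G x y d → Dist≤ G y x d
  dist-sym (l , l≤d , w) = dist-mono l≤d (walk-reverse w)

  diamAtMost-mono : ∀ {d e} → d ≤ e → DiamAtMost G d → DiamAtMost G e
  diamAtMost-mono d≤e D x y = dist-mono d≤e (D x y)

Adj⁼ : ∀ {n} → Graph n → Fin n → Fin n → Set
Adj⁼ G = ReflClosure (Adj G)

dist-adj⁼ : ∀ {n} {G : Graph n} {x y} → Adj⁼ G x y → Dist≤ G x y 1
dist-adj⁼ refl    = dist-mono z≤n dist-refl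
dist-adj⁼ [ x∼y ] = dist-adj x∼y

¬adj-sym : ∀ {n} (G : Graph n) {x y} → ¬ Adj G x y → ¬ Adj G y x
¬adj-sym G ¬x∼y = ¬x∼y ∘ sym G

module _ {n : ℕ} {G : Graph n} where

  avoid-start : ∀ {z a b} → AvoidReach G z a b → ¬ Adj G a z
  avoid-start (here ¬a∼z)     = ¬a∼z
  avoid-start (step ¬a∼z _ _) = ¬a∼z

  avoid-end : ∀ {z a b} → AvoidReach G z a b → ¬ Adj G b z
  avoid-end (here ¬b∼z)  = ¬b∼z
  avoid-end (step _ _ r) = avoid-end r

  avoid-end≢ : ∀ {z a b} → AvoidReach G z a b → a ≢ z → b ≢ z
  avoid-end≢ (here _)          a≢z = a≢z
  avoid-end≢ (step ¬a∼z a∼c r) _   = avoid-end≢ r λ { refl → ¬a∼z a∼c }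

  avoid-trans : ∀ {z a b c} → AvoidReach G z a b → AvoidReach G z b c → AvoidReach G z a c
  avoid-trans (here _)          r′ = r′
  avoid-trans (step ¬a∼z a∼d r) r′ = step ¬a∼z a∼d (avoid-trans r r′)

  avoid-sym : ∀ {z a b} → AvoidReach G z a b → AvoidReach G z b a
  avoid-sym (here ¬a∼z)       = here ¬a∼z
  avoid-sym (step ¬a∼z a∼c r) =
    avoid-trans (avoid-sym r) (step (avoid-start r) (sym G a∼c) (here ¬a∼z))

  -- If a vertex of the walk were adjacent to z, the walk would extend to z.
  avoid-switch : ∀ {v z a u} → AvoidReach G v a u → ¬ AvoidReach G v a z → ¬ Adj G z v →
                 AvoidReach G z a u
  avoid-switch (here ¬a∼v) a↛z ¬z∼v = here λ a∼z → a↛z (step ¬a∼v a∼z (here ¬z∼v))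
  avoid-switch (step ¬a∼v a∼b r) a↛z ¬z∼v =
    step (λ a∼z → a↛z (step ¬a∼v a∼z (here ¬z∼v))) a∼b
         (avoid-switch r (a↛z ∘ step ¬a∼v a∼b) ¬z∼v)

-- Contracting an edge

module _ {n : ℕ} {G : Graph (suc n)} {H : Graph n} (c : ContractEdge G H) where
  open ContractEdge c

  Endpoint : Fin (suc n) → Set
  Endpoint p = p ≡ u ⊎ p ≡ v

  endpoints-close : ∀ {p q} → Endpoint p → Endpoint q → Dist≤ G p q 1
  endpoints-close (inj₁ refl) (inj₁ refl) = dist-mono z≤n dist-refl
  endpoints-close (inj₁ refl) (inj₂ refl) = dist-adj edge
  endpoints-close (inj₂ refl) (inj₁ refl) = dist-adj (sym G edge)
  endpoints-close (inj₂ refl) (inj₂ refl) = dist-mono z≤n dist-refl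

  identified : ∀ {x y} → f x ≡ f y → x ≡ y ⊎ (Endpoint x × Endpoint y)
  identified {x} {y} fx≡fy with inj x y fx≡fy
  ... | inj₁ x≡y                = inj₁ x≡y
  ... | inj₂ (inj₁ (x≡u , y≡v)) = inj₂ (inj₁ x≡u , inj₂ y≡v)
  ... | inj₂ (inj₂ (x≡v , y≡u)) = inj₂ (inj₂ x≡v , inj₁ y≡u)

  NearEdge : Fin (suc n) → ℕ → Set
  NearEdge a i = ∃[ p ] (Endpoint p × Dist≤ G a p i)

  -- The distance from a to b in G with u and v identified is at most l.
  QuotientDist≤ : Fin (suc n) → Fin (suc n) → ℕ → Set
  QuotientDist≤ a b l = Dist≤ G a b l ⊎ ∃₂ λ i j → i + j ≤ l × NearEdge a i × NearEdge b j

  walk⇒quotientDist≤ : ∀ {α β l a b} → Walk H α β l → f a ≡ α → f b ≡ β → QuotientDist≤ a b l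
  walk⇒quotientDist≤ (nil _) fa fb with identified (trans fa (≡-sym fb))
  ... | inj₁ refl      = inj₁ dist-refl
  ... | inj₂ (ea , eb) = inj₂ (0 , 0 , z≤n , (_ , ea , dist-refl) , (_ , eb , dist-refl))
  walk⇒quotientDist≤ (cons α∼γ w) fa fb with adj→ _ _ α∼γ
  ... | _ , x , y , fx , fy , x∼y
      with identified (trans fx (≡-sym fa)) | walk⇒quotientDist≤ w fy fb
  ... | inj₁ refl | inj₁ y-b = inj₁ (dist-trans (dist-adj x∼y) y-b)
  ... | inj₁ refl | inj₂ (i , j , i+j≤l , (p , ep , y-p) , near-b) =
    inj₂ (suc i , j , s≤s i+j≤l , (p , ep , dist-trans (dist-adj x∼y) y-p) , near-b)
  ... | inj₂ (ex , ea) | inj₁ y-b =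
    inj₂ (0 , _ , ≤-refl , (_ , ea , dist-refl) ,
          (x , ex , dist-sym (dist-trans (dist-adj x∼y) y-b)))
  ... | inj₂ (ex , ea) | inj₂ (i , j , i+j≤l , _ , near-b) =
    inj₂ (0 , j , m≤n⇒m≤1+n (≤-trans (m≤n+m j i) i+j≤l) , (_ , ea , dist-refl) , near-b)

  quotientDist≤⇒dist≤ : ∀ {a b l} → QuotientDist≤ a b l → Dist≤ G a b (suc l)
  quotientDist≤⇒dist≤ (inj₁ a-b) = dist-mono (n≤1+n _) a-b
  quotientDist≤⇒dist≤ (inj₂ (i , j , i+j≤l , (p , ep , a-p) , (q , eq , b-q))) =
    dist-mono (≤-trans (≤-reflexive (+-suc i j)) (s≤s i+j≤l))
      (dist-trans a-p (dist-trans (endpoints-close ep eq) (dist-sym b-q)))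

  contractEdge-diam : ∀ {e} → DiamAtMost H e → DiamAtMost G (suc e)
  contractEdge-diam D a b with D (f a) (f b)
  ... | l , l≤e , w = dist-mono (s≤s l≤e) (quotientDist≤⇒dist≤ (walk⇒quotientDist≤ w refl refl))

  contractEdge-adj⁼ : ∀ {x y} → Adj⁼ G x y → Adj⁼ H (f x) (f y)
  contractEdge-adj⁼ refl = refl
  contractEdge-adj⁼ {x} {y} [ x∼y ] with f x ≟ f y
  ... | yes fx≡fy = subst (Adj⁼ H (f x)) fx≡fy refl
  ... | no fx≢fy  = [ adj← _ _ fx≢fy x y refl refl x∼y ]

contracts-diam : ∀ {n m k s} {G : Graph n} {K : Graph m} →
                 Contracts G K k → DiamAtMost K s → DiamAtMost G (k + s)
contracts-diam (done _)    D = D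
contracts-diam (step c cs) D = contractEdge-diam c (contracts-diam cs D)

-- v is sent to the place of u, then Fin (suc n) ∖ {v} is renumbered onto Fin n by punchOut.
module Contraction {n : ℕ} (G : Graph (suc n)) {u v : Fin (suc n)} (u∼v : Adj G u v) where

  u≢v : u ≢ v
  u≢v refl = irrefl G u∼v

  redirect : Fin (suc n) → Fin (suc n)
  redirect x with x ≟ v
  ... | yes _ = u
  ... | no _  = x

  v≢redirect : ∀ x → v ≢ redirect x
  v≢redirect x with x ≟ v
  ... | yes _   = u≢v ∘ ≡-sym
  ... | no x≢v  = x≢v ∘ ≡-sym

  redirect-fix : ∀ {x} → x ≢ v → redirect x ≡ x
  redirect-fix {x} x≢v with x ≟ v
  ... | yes x≡v = ⊥-elim (x≢v x≡v)
  ... | no _    = refl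

  redirect-v : redirect v ≡ u
  redirect-v with v ≟ v
  ... | yes _   = refl
  ... | no v≢v  = ⊥-elim (v≢v refl)

  redirect-inj : ∀ x y → redirect x ≡ redirect y → x ≡ y ⊎ ((x ≡ u × y ≡ v) ⊎ (x ≡ v × y ≡ u))
  redirect-inj x y with x ≟ v | y ≟ v
  ... | yes refl | yes refl = λ _ → inj₁ refl
  ... | yes refl | no _     = λ u≡y → inj₂ (inj₂ (refl , ≡-sym u≡y))
  ... | no _     | yes refl = λ x≡u → inj₂ (inj₁ (x≡u , refl))
  ... | no _     | no _     = inj₁

  f : Fin (suc n) → Fin n
  f x = punchOut (v≢redirect x)

  f-onto : ∀ a → ∃[ x ] (f x ≡ a)
  f-onto a = punchIn v a ,
    trans (punchOut-cong v (redirect-fix (punchInᵢ≢i v a))) (punchOut-punchIn v)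

  QAdj : Fin n → Fin n → Set
  QAdj a b = a ≢ b × ∃[ x ] ∃[ y ] (f x ≡ a × f y ≡ b × Adj G x y)

  H : Graph n
  H = record
    { Adj    = QAdj
    ; sym    = λ (a≢b , x , y , fx , fy , x∼y) → a≢b ∘ ≡-sym , y , x , fy , fx , sym G x∼y
    ; irrefl = λ (a≢a , _) → a≢a refl
    }

  contraction : ContractEdge G H
  contraction = record
    { u     = u
    ; v     = v
    ; edge  = u∼v
    ; f     = f
    ; fuv   = punchOut-cong v (trans (redirect-fix u≢v) (≡-sym redirect-v))
    ; onto  = f-onto
    ; inj   = λ x y fx≡fy →
                redirect-inj x y (punchOut-injective (v≢redirect x) (v≢redirect y) fx≡fy)
    ; adj→  = λ _ _ a∼b → a∼b
    ; adj←  = λ _ _ a≢b x y fx fy x∼y → a≢b , x , y , fx , fy , x∼y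
    }

-- Dominating chains

Dominates : ∀ {n} → Graph n → List (Fin n) → Set
Dominates G L = ∀ z → Any (Adj⁼ G z) L

-- Consecutive vertices may coincide, since contracting an edge can merge neighbours of a walk.
record DominatingChain {n : ℕ} (G : Graph n) (c : ℕ) : Set where
  constructor dominatingChain
  field
    start     : Fin n
    rest      : List (Fin n)
    length≤   : length rest ≤ c
    linked    : Linked (Adj⁼ G) (start ∷ rest)
    dominates : Dominates G (start ∷ rest)

module _ {n : ℕ} {G : Graph n} where

  dominates-merge : ∀ {x y ys} → x ≡ y → Dominates G (x ∷ y ∷ ys) → Dominates G (y ∷ ys)
  dominates-merge refl dom z = [ here , id ]′ (Any.toSum (dom z))

  linked-dist-start : ∀ {x ys b} → Linked (Adj⁼ G) (x ∷ ys) → b ∈ x ∷ ys →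
                      Dist≤ G x b (length ys)
  linked-dist-start _         (here refl) = dist-mono z≤n dist-refl
  linked-dist-start [-]       (there ())
  linked-dist-start (x∼y ∷ L) (there b∈)  = dist-trans (dist-adj⁼ x∼y) (linked-dist-start L b∈)

  linked-dist : ∀ {x ys a b} → Linked (Adj⁼ G) (x ∷ ys) → a ∈ x ∷ ys → b ∈ x ∷ ys →
                Dist≤ G a b (length ys)
  linked-dist L       (here refl) b∈          = linked-dist-start L b∈
  linked-dist L       a∈          (here refl) = dist-sym (linked-dist-start L a∈)
  linked-dist [-]     (there ())  _
  linked-dist (_ ∷ L) (there a∈)  (there b∈)  = dist-mono (n≤1+n _) (linked-dist L a∈ b∈)

  dominatingChain-diam : ∀ {c} → DominatingChain G c → DiamAtMost G (2 + c)
  dominatingChain-diam {c} (dominatingChain _ ys len≤ linked dom) α β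
    with find (dom α) | find (dom β)
  ... | _ , p∈ , α∼p | _ , q∈ , β∼q =
    dist-mono (s≤s (subst (_≤ suc c) (+-comm 1 (length ys)) (s≤s len≤)))
      (dist-trans (dist-adj⁼ α∼p)
        (dist-trans (linked-dist linked p∈ q∈) (dist-sym (dist-adj⁼ β∼q))))

  visits : ∀ {x y l} → Walk G x y l → List (Fin n)
  visits (nil _)            = []
  visits (cons {y = y} _ w) = y ∷ visits w

  length-visits : ∀ {x y l} (w : Walk G x y l) → length (visits w) ≡ l
  length-visits (nil _)    = refl
  length-visits (cons _ w) = cong suc (length-visits w)

  walk-linked : ∀ {x y l} (w : Walk G x y l) → Linked (Adj⁼ G) (x ∷ visits w)
  walk-linked (nil _)      = [-]
  walk-linked (cons x∼y w) = [ x∼y ] ∷ walk-linked w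

  module _ (adj? : ∀ x y → Dec (Adj G x y)) where

    adj⁼? : ∀ x y → Dec (Adj⁼ G x y)
    adj⁼? x y with x ≟ y | adj? x y
    ... | yes refl | _       = yes refl
    ... | no _     | yes x∼y = yes [ x∼y ]
    ... | no x≢y   | no ¬x∼y = no λ { refl → x≢y refl ; [ x∼y ] → ¬x∼y x∼y }

    touches-or-avoids : ∀ z {a b l} (w : Walk G a b l) →
                        Any (Adj⁼ G z) (a ∷ visits w) ⊎ AvoidReach G z a b
    touches-or-avoids z (nil a) with adj⁼? z a
    ... | yes z∼a = inj₁ (here z∼a)
    ... | no z≁a  = inj₂ (here (z≁a ∘ [_] ∘ sym G))
    touches-or-avoids z (cons {x = a} a∼b w) with adj⁼? z a
    ... | yes z∼a = inj₁ (here z∼a)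
    ... | no z≁a  = Sum.map there (step (z≁a ∘ [_] ∘ sym G) a∼b) (touches-or-avoids z w)

-- Every a–b walk dominates G: a vertex z ≠ a neither on nor next to such a walk would
-- give an a–b walk avoiding N(z).
DominatingPair : ∀ {n} → Graph n → Fin n → Fin n → Set
DominatingPair G a b = ∀ z → a ≢ z → ¬ AvoidReach G z a b

walk-dominates : ∀ {n} {G : Graph n} → (∀ x y → Dec (Adj G x y)) → ∀ {a b l} →
                 DominatingPair G a b → (w : Walk G a b l) → Dominates G (a ∷ visits w)
walk-dominates adj? {a} dp w z with z ≟ a
... | yes refl = here refl
... | no z≢a   = [ id , ⊥-elim ∘ dp z (z≢a ∘ ≡-sym) ]′ (touches-or-avoids adj? z w)

contractEdge-dominates : ∀ {n} {G : Graph (suc n)} {H : Graph n} (c : ContractEdge G H) {L} →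
                         Dominates G L → Dominates H (map (ContractEdge.f c) L)
contractEdge-dominates c dom z with ContractEdge.onto c z
... | x , refl = Anyₚ.map⁺ (Any.map (contractEdge-adj⁼ c) (dom x))

ContractsWithin : ∀ {n} → Graph n → ℕ → (∀ {m} → Graph m → Set) → Set₁
ContractsWithin G t P = ∃[ j ] (j ≤ t × Σ ℕ λ m → Σ (Graph m) λ K → Contracts G K j × P K)

module _ {P : ∀ {m} → Graph m → Set} where

  within-done : ∀ {n t} {G : Graph n} → P G → ContractsWithin G t P
  within-done {G = G} PG = 0 , z≤n , _ , G , done G , PG

  within-suc : ∀ {n t} {G : Graph n} → ContractsWithin G t P → ContractsWithin G (suc t) P
  within-suc (j , j≤t , K) = j , m≤n⇒m≤1+n j≤t , K

  within-step : ∀ {n t} {G : Graph (suc n)} {H : Graph n} →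
                ContractEdge G H → ContractsWithin H t P → ContractsWithin G (suc t) P
  within-step e (j , j≤t , m , K , cs , PK) = suc j , s≤s j≤t , m , K , step e cs , PK

shorten-dominatingChain : ∀ t {c n} {G : Graph n} → DominatingChain G (t + c) →
                          ContractsWithin G t (λ K → DominatingChain K c)
shorten-dominatingChain _ (dominatingChain x [] _ linked dom) =
  within-done (dominatingChain x [] z≤n linked dom)
shorten-dominatingChain zero D = within-done D
shorten-dominatingChain (suc t) {c} {G = G}
    (dominatingChain _ (y ∷ ys) (s≤s len≤) (refl ∷ linked) dom) =
  within-suc (shorten-dominatingChain t {c} {G = G}
               (dominatingChain y ys len≤ linked (dominates-merge {G = G} refl dom)))
shorten-dominatingChain (suc t) {n = zero} (dominatingChain () _ _ _ _)
shorten-dominatingChain (suc t) {c} {n = suc _} {G}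
    (dominatingChain _ (y ∷ ys) (s≤s len≤) ([ x∼y ] ∷ linked) dom) =
  within-step contraction (shorten-dominatingChain t {c} {G = H}
    (dominatingChain (f y) (map f ys)
       (subst (_≤ t + c) (≡-sym (length-map f ys)) len≤)
       (Linkedₚ.map⁺ (Linked.map (contractEdge-adj⁼ contraction) linked))
       (dominates-merge {G = H} (ContractEdge.fuv contraction)
                        (contractEdge-dominates contraction dom))))
  where open Contraction G x∼y

module _ {n : ℕ} {P : Fin n → Set} (P? : ∀ x → Dec (P x)) where

  subset : Subset n
  subset = tabulate (does ∘ P?)

  ∈-subset⁺ : ∀ {x} → P x → x ∈ₛ subset
  ∈-subset⁺ {x} px =
    lookup⇒[]= x subset (trans (lookup∘tabulate (does ∘ P?) x) (dec-true (P? x) px))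

  ∈-subset⁻ : ∀ {x} → x ∈ₛ subset → P x
  ∈-subset⁻ {x} x∈ with P? x | trans (≡-sym (lookup∘tabulate (does ∘ P?) x)) ([]=⇒lookup x∈)
  ... | yes px | _ = px
  ... | no _   | ()

subset-⊂ : ∀ {n} {P Q : Fin n → Set} (P? : ∀ x → Dec (P x)) (Q? : ∀ x → Dec (Q x)) →
           (∀ {x} → P x → Q x) → ∀ {y} → Q y → ¬ P y → subset P? ⊂ subset Q?
subset-⊂ P? Q? P⊆Q Qy ¬Py =
  ∈-subset⁺ Q? ∘ P⊆Q ∘ ∈-subset⁻ P? , _ , ∈-subset⁺ Q? Qy , ¬Py ∘ ∈-subset⁻ P?

∈⇒∣p∣>0 : ∀ {n} {p : Subset n} {x} → x ∈ₛ p → 0 < ∣ p ∣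
∈⇒∣p∣>0 {n} {p} x∈p = subst (_< ∣ p ∣) (∣⊥∣≡0 n) (p⊂q⇒∣p∣<∣q∣ (⊥⊆ , _ , x∈p , ∉⊥))

∣p∣>0⇒nonempty : ∀ {n} {p : Subset n} → 0 < ∣ p ∣ → Nonempty p
∣p∣>0⇒nonempty {n} {p} ∣p∣>0 with nonempty? p
... | yes ne = ne
... | no empty = ⊥-elim (<-irrefl refl
                   (subst (0 <_) (∣⊥∣≡0 n) (subst (λ q → 0 < ∣ q ∣) (Empty-unique empty) ∣p∣>0)))

maximum : ∀ {A : Set} (f : A → ℕ) (a₀ : A) (xs : List A) → (∀ a → a ∈ xs) →
          ∃[ m ] (∀ a → f a ≤ f m)
maximum f a₀ xs complete =
  argmax f a₀ xs , λ a → All.lookup (f[xs]≤f[argmax] {f = f} a₀ xs) (complete a)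

maximum-Fin : ∀ {n} (f : Fin (suc n) → ℕ) → ∃[ m ] (∀ a → f a ≤ f m)
maximum-Fin f = maximum f zero (allFin _) ∈-allFin

maximum-Fin₂ : ∀ {n} (f : Fin (suc n) → Fin (suc n) → ℕ) → ∃₂ λ x w → ∀ z w′ → f z w′ ≤ f x w
maximum-Fin₂ f =
  let (x , w) , maximal = maximum (uncurry f) (zero , zero) (cartesianProduct (allFin _) (allFin _))
                            (λ (x , w) → ∈-cartesianProduct⁺ (∈-allFin x) (∈-allFin w))
  in x , w , λ z w′ → maximal (z , w′)

-- Dominating pairs in AT-free graphs

module DominatingPairs {n : ℕ} (G : Graph (suc n)) (atf : ATFree G)
    (reach? : ∀ z a b → Dec (AvoidReach G z a b)) where

  -- Component x w is the component of G − N[x] containing w; it is empty when w ∈ N[x].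
  Component : Fin (suc n) → Fin (suc n) → Fin (suc n) → Set
  Component x w u = x ≢ w × AvoidReach G x w u

  component? : ∀ x w u → Dec (Component x w u)
  component? x w u = ¬? (x ≟ w) ×-dec reach? x w u

  componentSize : Fin (suc n) → Fin (suc n) → ℕ
  componentSize x w = ∣ subset (component? x w) ∣

  component-root : ∀ {x w u} → Component x w u → Component x w w
  component-root (x≢w , w→u) = x≢w , here (avoid-start w→u)

  component-swap : ∀ {x w} → Component x w w → Component w x x
  component-swap (x≢w , w→w) = ≢-sym x≢w , here (¬adj-sym G (avoid-start w→w))

  component-nonempty : ∀ {x w} → (∀ z w′ → componentSize z w′ ≤ componentSize x w) →
                       ∀ {z u} → Component z u u → ∃[ v ] Component x w v
  component-nonempty maximal {z} {u} u∈ =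
    let v , v∈ = ∣p∣>0⇒nonempty (≤-trans (∈⇒∣p∣>0 (∈-subset⁺ (component? z u) u∈)) (maximal z u))
    in v , ∈-subset⁻ (component? _ _) v∈

  Inner : Fin (suc n) → Fin (suc n) → Fin (suc n) → Fin (suc n) → Set
  Inner x w y u = Component x w y × Component y x u

  inner? : ∀ x w y u → Dec (Inner x w y u)
  inner? x w y u = component? x w y ×-dec component? y x u

  innerSize : Fin (suc n) → Fin (suc n) → Fin (suc n) → ℕ
  innerSize x w y = ∣ subset (inner? x w y) ∣

  module _ {x w} (maximal : ∀ z w′ → componentSize z w′ ≤ componentSize x w) where

    dominatingPair-degenerate : ¬ Component x w w → DominatingPair G x x
    dominatingPair-degenerate w∉ z x≢z x→x =
      w∉ (component-root (proj₂ (component-nonempty maximal (component-swap (≢-sym x≢z , x→x)))))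

    module _ (w∈ : Component x w w) {y} (y-max : ∀ z → innerSize x w z ≤ innerSize x w y) where

      w≢x : w ≢ x
      w≢x = ≢-sym (proj₁ w∈)

      y∈ : Component x w y
      y∈ = let _ , u∈ = ∣p∣>0⇒nonempty (≤-trans (∈⇒∣p∣>0 (∈-subset⁺ (inner? x w w)
                                                       (w∈ , component-swap w∈))) (y-max w))
           in proj₁ (∈-subset⁻ (inner? x w y) u∈)

      dominatingPair : DominatingPair G x y
      dominatingPair z x≢z x→y with reach? x y z
      ... | no y↛z =
        <⇒≱ (p⊂q⇒∣p∣<∣q∣ (subset-⊂ (component? x w) (component? z x) grow x∈ x∉)) (maximal z x)
        where
        grow : ∀ {u} → Component x w u → Component z x u
        grow (_ , w→u) = ≢-sym x≢z ,
          avoid-trans x→y (avoid-switch (avoid-trans (avoid-sym (proj₂ y∈)) w→u) y↛z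
                                        (¬adj-sym G (avoid-start x→y)))
        x∈ : Component z x x
        x∈ = ≢-sym x≢z , here (avoid-start x→y)
        x∉ : ¬ Component x w x
        x∉ (_ , w→x) = avoid-end≢ w→x w≢x refl
      ... | yes y→z with reach? y x z
      ...   | yes x→z = atf x y z
        ( ≢-sym (avoid-end≢ (proj₂ y∈) w≢x) , avoid-end≢ x→y x≢z , x≢z
        , ¬adj-sym G (avoid-end (proj₂ y∈)) , avoid-end x→y , avoid-start x→y
        , x→y , y→z , x→z )
      ...   | no x↛z =
        <⇒≱ (p⊂q⇒∣p∣<∣q∣ (subset-⊂ (inner? x w y) (inner? x w z) grow y∈′ y∉)) (y-max z)
        where
        z∈ : Component x w z
        z∈ = proj₁ y∈ , avoid-trans (proj₂ y∈) y→z
        grow : ∀ {u} → Inner x w y u → Inner x w z u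
        grow (_ , _ , x→u) = z∈ , ≢-sym x≢z , avoid-switch x→u x↛z (¬adj-sym G (avoid-end x→y))
        y∈′ : Inner x w z y
        y∈′ = z∈ , ≢-sym x≢z , x→y
        y∉ : ¬ Inner x w y y
        y∉ (_ , _ , x→y′) = avoid-end≢ x→y′ (≢-sym (avoid-end≢ (proj₂ y∈) w≢x)) refl

    dominatingPair-from-maximal : ∃₂ λ a b → DominatingPair G a b
    dominatingPair-from-maximal with component? x w w
    ... | no w∉  = x , x , dominatingPair-degenerate w∉
    ... | yes w∈ = let y , y-max = maximum-Fin (innerSize x w) in x , y , dominatingPair w∈ y-max

  atFree⇒dominatingPair : ∃₂ λ a b → DominatingPair G a b
  atFree⇒dominatingPair =
    let x , w , maximal = maximum-Fin₂ componentSize in dominatingPair-from-maximal {x} {w} maximal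

contractions-suffice : ∀ {n} {G : Graph n} → ATFree G → (∀ x y → Dec (Adj G x y)) →
                       (∀ z a b → Dec (AvoidReach G z a b)) →
                       ∀ t c → DiamAtMost G (t + c) →
                       ContractsWithin G t (λ K → DiamAtMost K (2 + c))
contractions-suffice {zero} _ _ _ _ _ _ = within-done λ ()
contractions-suffice {suc _} {G} atf adj? reach? t c D =
  let a , b , dp = DominatingPairs.atFree⇒dominatingPair G atf reach?
      l , l≤ , w = D a b
      chain = dominatingChain a (visits w) (subst (_≤ t + c) (≡-sym (length-visits w)) l≤)
                              (walk-linked w) (walk-dominates adj? dp w)
      j , j≤t , m , K , cs , shortChain = shorten-dominatingChain t {c} {G = G} chain
  in j , j≤t , m , K , cs , dominatingChain-diam shortChain

contractions-lower : ∀ {n} {G : Graph n} {s d k} → Diam G d → Achieves G s k → d ∸ s ≤ k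
contractions-lower {s = s} {d} {k} (_ , least) (_ , _ , cs , D) =
  m≤n+o⇒m∸n≤o d s (subst (d ≤_) (+-comm k s) (least _ (contracts-diam cs D)))

¬¬-Π-Fin : ∀ {n} {P : Fin n → Set} → (∀ i → ¬ ¬ P i) → ¬ ¬ (∀ i → P i)
¬¬-Π-Fin {zero}  _  k = k λ ()
¬¬-Π-Fin {suc n} ¬¬P k =
  ¬¬P zero λ P₀ → ¬¬-Π-Fin (¬¬P ∘ suc) λ Pₛ → k λ { zero → P₀ ; (suc i) → Pₛ i }

-- Adjacency is an arbitrary Set-valued relation, so its decidability is only available under
-- a double negation; the goal k ≤ … is decidable, hence stable.
contractions-upper : ∀ {n} {G : Graph n} {c d k} → ATFree G → DiamAtMost G d →
                     (∀ j → Achieves G (2 + c) j → k ≤ j) → k ≤ d ∸ (2 + c) + 2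
contractions-upper {G = G} {c} {d} {k} atf D least = decidable-stable (k ≤? t) λ k≰t →
  ¬¬-Π-Fin (λ x → ¬¬-Π-Fin λ y → ¬¬-excluded-middle) λ adj? →
  ¬¬-Π-Fin (λ z → ¬¬-Π-Fin λ a → ¬¬-Π-Fin λ b → ¬¬-excluded-middle) λ reach? →
  let j , j≤t , achieves =
        contractions-suffice {G = G} atf adj? reach? t c (diamAtMost-mono d≤t+c D)
  in k≰t (≤-trans (least j achieves) j≤t)
  where
  t = d ∸ (2 + c) + 2
  d≤t+c : d ≤ t + c
  d≤t+c = subst (d ≤_) (trans (+-comm (2 + c) _) (≡-sym (+-assoc (d ∸ (2 + c)) 2 c)))
                (m≤n+m∸n d (2 + c))

lemma10 : ∀ {n} (G : Graph n) → Connected G → ATFree G →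
          ∀ (s d k : ℕ) → 2 ≤ s → Diam G d → s < d →
          MinContractions G s k →
          (d ∸ s ≤ k) × (k ≤ d ∸ s + 2)
lemma10 G _ atf (suc (suc c)) d k (s≤s (s≤s z≤n)) D _ (achieves , least) =
  contractions-lower {G = G} D achieves , contractions-upper {G = G} atf (proj₁ D) least
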